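{- Let $G$ be a finite graph without loops with vertices $v_0,\ldots,v_n$ and let $r \geq 0$. Then \[ \operatorname{gon}_r(G) = \min\{ d \geq r \mid \exists D \in \operatorname{Jac}(G) \text{ such that } D - r\mathcal{A}(G) \subseteq (d-r)\mathcal{A}(G)\}. \]
   Context: Divisors, equivalence via the Laplacian, $\operatorname{Jac}(G)$ (degree-zero divisor classes), and rank are as usual: the rank of $D$ is $-1$ if $D$ is not equivalent to an effective divisor, otherwise the largest $r$ with $D-E$ equivalent to an effective divisor for all effective $E$ of degree $r$. The $r$-gonality $\operatorname{gon}_r(G)$ is the minimum degree of a divisor of rank at least $r$. $\mathcal{A}(G) = \{[v_i - v_0] \mid 0\le i\le n\} \subseteq \operatorname{Jac}(G)$; $m\mathcal{A}(G)$ is the set of sums of $m$ elements of $\mathcal{A}(G)$ (with $0\mathcal{A}(G)=\{0\}$), and $D - r\mathcal{A}(G) = \{D - a \mid a\in r\mathcal{A}(G)\}$. -}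

module Defs where

open import Data.Nat using (ℕ; zero; suc; _∸_) renaming (_≤_ to _≤ℕ_)
open import Data.Integer using (ℤ; +_; _+_; _-_; _*_; _≤_)
open import Data.Fin using (Fin; zero; suc; _≟_)
open import Data.Product using (Σ; ∃; _×_; _,_)
open import Relation.Nullary using (does)
open import Data.Bool using (if_then_else_)
open import Relation.Binary.PropositionalEquality using (_≡_)
open import Function.Bundles using (_⇔_)

-- A finite multigraph without loops on vertices v_0, …, v_n  (= Fin (suc n)).
-- mult i j is the number of edges between v_i and v_j.
record Graph (n : ℕ) : Set where
  field
    mult     : Fin (suc n) → Fin (suc n) → ℕ
    symmetric : ∀ i j → mult i j ≡ mult j i
    loopless : ∀ i → mult i i ≡ 0
open Graph public

Vertex : ℕ → Set
Vertex n = Fin (suc n)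

sumFin : ∀ {m} → (Fin m → ℤ) → ℤ
sumFin {zero}  f = + 0
sumFin {suc m} f = f zero + sumFin (λ i → f (suc i))

Divisor : ℕ → Set
Divisor n = Vertex n → ℤ

deg : ∀ {n} → Divisor n → ℤ
deg D = sumFin D

_⊕_ : ∀ {n} → Divisor n → Divisor n → Divisor n
(D ⊕ E) v = D v + E v

_⊖_ : ∀ {n} → Divisor n → Divisor n → Divisor n
(D ⊖ E) v = D v - E v

Effective : ∀ {n} → Divisor n → Set
Effective D = ∀ v → + 0 ≤ D v

point : ∀ {n} → Vertex n → Divisor n
point v w = if does (v ≟ w) then + 1 else + 0

laplacian : ∀ {n} → Graph n → (Vertex n → ℤ) → Divisor n
laplacian G f v = sumFin (λ w → + (mult G v w) * (f v - f w))

Equiv : ∀ {n} → Graph n → Divisor n → Divisor n → Set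
Equiv {n} G D D' = Σ (Vertex n → ℤ) λ f → ∀ v → D v - D' v ≡ laplacian G f v

EquivEffective : ∀ {n} → Graph n → Divisor n → Set
EquivEffective {n} G D = Σ (Divisor n) λ F → Effective F × Equiv G D F

RankAtLeast : ∀ {n} → Graph n → Divisor n → ℕ → Set
RankAtLeast {n} G D r =
  (E : Divisor n) → Effective E → deg E ≡ + r → EquivEffective G (D ⊖ E)

IsGonality : ∀ {n} → Graph n → ℕ → ℕ → Set
IsGonality {n} G r g =
  (Σ (Divisor n) λ D → deg D ≡ + g × RankAtLeast G D r)
  × ((D : Divisor n) → RankAtLeast G D r → + g ≤ deg D)

-- Representative of the element [v_i - v_0] of A(G).
aElt : ∀ {n} → Vertex n → Divisor n
aElt v = point v ⊖ point zero

aSum : ∀ {n m} → (Fin m → Vertex n) → Divisor n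
aSum is v = sumFin (λ k → aElt (is k) v)

-- Elements of Jac(G) are represented by degree-zero divisors; equality in Jac(G)
-- is linear equivalence.  "D - r A(G) ⊆ (d - r) A(G)":
SubsetCond : ∀ {n} → Graph n → Divisor n → ℕ → ℕ → Set
SubsetCond {n} G D r d =
  (is : Fin r → Vertex n) →
  Σ (Fin (d ∸ r) → Vertex n) λ js → Equiv G (D ⊖ aSum is) (aSum js)

JacCond : ∀ {n} → Graph n → ℕ → ℕ → Set
JacCond {n} G r d =
  r ≤ℕ d × (Σ (Divisor n) λ D → deg D ≡ + 0 × SubsetCond G D r d)

IsMinimum : (ℕ → Set) → ℕ → Set
IsMinimum P g = P g × (∀ d → P d → g ≤ℕ d)

-- An element D₀ of Jac(G) corresponds to the degree-d divisor D = D₀ + d·v₀, and a sum of m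
-- elements [v_i - v₀] of A(G) is v_{i₁} + … + v_{iₘ} - m·v₀. Effective divisors of degree m are
-- exactly such sums of m vertices, and with d = r + k the shifts by v₀ cancel:
-- D₀ - Σ[v_i - v₀] ~ Σ[v_j - v₀] is literally D - Σ v_i ~ Σ v_j. So D₀ - rA(G) ⊆ (d-r)A(G)
-- says precisely that D - E is equivalent to an effective divisor for every effective E of
-- degree r, i.e. rank D ≥ r. A divisor of rank ≥ r has degree ≥ r ≥ 0, so the minima over
-- degrees of such divisors and over the admissible d coincide.

module Submission where

open import Defs
open import Data.Nat using (ℕ)
open import Function.Bundles using (_⇔_)

open import Data.Nat as ℕ using (zero; suc; _∸_; z≤n; s≤s)
open import Data.Nat.Properties using (m+[n∸m]≡n; n∸n≡0; ≤-refl)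
open import Data.Integer using (ℤ; +_; _+_; _-_; -_; _*_; _≤_; +≤+; ∣_∣)
open import Data.Integer.Properties
  using ( +-identityˡ; +-identityʳ; +-assoc; +-comm; +-inverseʳ; neg-distrib-+; suc-*
        ; *-zeroʳ; *-identityʳ; +-monoʳ-≤; +-mono-≤; i≤j⇒i≤k+j; ≤-trans; ≤-reflexive; ≤-antisym
        ; 0≤i-j⇒j≤i; i≤j⇒0≤j-i; i-j≡0⇒i≡j; drop‿+≤+; 0≤i⇒+∣i∣≡i; m-n≡m⊖n; ⊖-≥
        ; +-commutativeSemigroup; +-0-abelianGroup; +-*-ring )
open import Data.Integer.Base using (nonNegative)
open import Data.Integer.Tactic.RingSolver using (solve-∀)
open import Algebra.Properties.CommutativeSemigroup +-commutativeSemigroup using (interchange)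
open import Algebra.Properties.AbelianGroup +-0-abelianGroup using (//-rightDividesˡ)
open import Algebra.Properties.Ring +-*-ring using (x[y-z]≈xy-xz)
open import Data.Fin using (Fin; zero; suc; _≟_; _↑ˡ_; _↑ʳ_)
open import Data.Vec.Functional using (_∷_)
open import Data.Product using (Σ; ∃; _×_; _,_)
import Data.Product as Product
open import Data.Sum using (_⊎_; inj₁; inj₂)
open import Function.Base using (_∘_; const; id)
open import Function.Bundles using (mk⇔; Equivalence)
open import Function.Construct.Composition using (_⇔-∘_)
open import Relation.Nullary using (yes; no)
open import Relation.Binary.PropositionalEquality
  using (_≡_; refl; sym; trans; cong; cong₂; subst; module ≡-Reasoning)

open Equivalence using (to; from)

sumFin-cong : ∀ {m} {f g : Fin m → ℤ} → (∀ i → f i ≡ g i) → sumFin f ≡ sumFin g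
sumFin-cong {zero}  f≗g = refl
sumFin-cong {suc m} f≗g = cong₂ _+_ (f≗g zero) (sumFin-cong (f≗g ∘ suc))

sumFin-+ : ∀ {m} (f g : Fin m → ℤ) → sumFin (λ i → f i + g i) ≡ sumFin f + sumFin g
sumFin-+ {zero}  f g = refl
sumFin-+ {suc m} f g =
  trans (cong (_+_ (f zero + g zero)) (sumFin-+ (f ∘ suc) (g ∘ suc)))
        (interchange (f zero) (g zero) (sumFin (f ∘ suc)) (sumFin (g ∘ suc)))

sumFin-neg : ∀ {m} (f : Fin m → ℤ) → sumFin (λ i → - f i) ≡ - sumFin f
sumFin-neg {zero}  f = refl
sumFin-neg {suc m} f =
  trans (cong (_+_ (- f zero)) (sumFin-neg (f ∘ suc)))
        (sym (neg-distrib-+ (f zero) (sumFin (f ∘ suc))))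

sumFin-minus : ∀ {m} (f g : Fin m → ℤ) → sumFin (λ i → f i - g i) ≡ sumFin f - sumFin g
sumFin-minus f g = trans (sumFin-+ f (-_ ∘ g)) (cong (_+_ (sumFin f)) (sumFin-neg g))

sumFin-const : ∀ m (c : ℤ) → sumFin {m} (const c) ≡ + m * c
sumFin-const zero    c = sym (*-zeroʳ (+ 0))
sumFin-const (suc m) c = trans (cong (_+_ c) (sumFin-const m c)) (sym (suc-* (+ m) c))

sumFin-comm : ∀ {m k} (h : Fin m → Fin k → ℤ) →
              sumFin (λ i → sumFin (h i)) ≡ sumFin (λ j → sumFin (λ i → h i j))
sumFin-comm {zero}  {k} h = sym (trans (sumFin-const k (+ 0)) (*-zeroʳ (+ k)))
sumFin-comm {suc m} h =
  trans (cong (_+_ (sumFin (h zero))) (sumFin-comm (h ∘ suc))) (sym (sumFin-+ (h zero) _))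

sumFin-++ : ∀ {m k} (f : Fin (m ℕ.+ k) → ℤ) →
            sumFin f ≡ sumFin (f ∘ (_↑ˡ k)) + sumFin (f ∘ (m ↑ʳ_))
sumFin-++ {zero}  f = sym (+-identityˡ _)
sumFin-++ {suc m} {k} f =
  trans (cong (_+_ (f zero)) (sumFin-++ {m} (f ∘ suc)))
        (sym (+-assoc (f zero) (sumFin (f ∘ suc ∘ (_↑ˡ k))) (sumFin (f ∘ suc ∘ (m ↑ʳ_)))))

sumFin-nonneg : ∀ {m} {f : Fin m → ℤ} → (∀ i → + 0 ≤ f i) → + 0 ≤ sumFin f
sumFin-nonneg {zero}  f≥0 = +≤+ z≤n
sumFin-nonneg {suc m} f≥0 = +-mono-≤ (f≥0 zero) (sumFin-nonneg (f≥0 ∘ suc))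

term≤sumFin : ∀ {m} {f : Fin m → ℤ} → (∀ i → + 0 ≤ f i) → ∀ i → f i ≤ sumFin f
term≤sumFin {f = f} f≥0 zero =
  ≤-trans (≤-reflexive (sym (+-identityʳ (f zero))))
          (+-monoʳ-≤ (f zero) (sumFin-nonneg (f≥0 ∘ suc)))
term≤sumFin {f = f} f≥0 (suc i) =
  i≤j⇒i≤k+j (f zero) {{nonNegative (f≥0 zero)}} (term≤sumFin (f≥0 ∘ suc) i)

sumFin≡0⇒≡0 : ∀ {m} {f : Fin m → ℤ} → (∀ i → + 0 ≤ f i) → sumFin f ≡ + 0 → ∀ i → f i ≡ + 0
sumFin≡0⇒≡0 {f = f} f≥0 Σf≡0 i = ≤-antisym (subst (f i ≤_) Σf≡0 (term≤sumFin f≥0 i)) (f≥0 i)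

+-positive-summand : ∀ {x y m} → + 0 ≤ x → x + y ≡ + suc m → + 1 ≤ x ⊎ y ≡ + suc m
+-positive-summand {+ zero}  {y} _ x+y≡ = inj₂ (trans (sym (+-identityˡ y)) x+y≡)
+-positive-summand {+ suc _}     _ _    = inj₁ (+≤+ (s≤s z≤n))

sumFin-positive-term : ∀ {m k} {f : Fin k → ℤ} → (∀ i → + 0 ≤ f i) → sumFin f ≡ + suc m →
                       ∃ λ i → + 1 ≤ f i
sumFin-positive-term {k = zero}  _   ()
sumFin-positive-term {k = suc k} f≥0 Σf≡ with +-positive-summand (f≥0 zero) Σf≡
... | inj₁ 1≤f₀  = zero , 1≤f₀
... | inj₂ Σf′≡ = Product.map suc id (sumFin-positive-term (f≥0 ∘ suc) Σf′≡)

IsMinimum-cong : ∀ {P Q : ℕ → Set} → (∀ d → P d ⇔ Q d) → ∀ g → IsMinimum P g ⇔ IsMinimum Q g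
IsMinimum-cong P⇔Q g = mk⇔
  (λ (Pg , minimal) → to (P⇔Q g) Pg , λ d Qd → minimal d (from (P⇔Q d) Qd))
  (λ (Qg , minimal) → from (P⇔Q g) Qg , λ d Pd → minimal d (to (P⇔Q d) Pd))

-- The suc case relies on point (suc u) (suc w) reducing to point u w.
deg-point : ∀ {n} (u : Vertex n) → deg (point u) ≡ + 1
deg-point {n}     zero    = cong (_+_ (+ 1)) (trans (sumFin-const n (+ 0)) (*-zeroʳ (+ n)))
deg-point {suc n} (suc u) = trans (+-identityˡ _) (deg-point u)

module _ {n : ℕ} where

  point-nonneg : (u v : Vertex n) → + 0 ≤ point u v
  point-nonneg u v with u ≟ v
  ... | yes _ = +≤+ z≤n
  ... | no _  = +≤+ z≤n

  pointSum : ∀ {m} → (Fin m → Vertex n) → Divisor n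
  pointSum is v = sumFin (λ k → point (is k) v)

  pointSum-effective : ∀ {m} (is : Fin m → Vertex n) → Effective (pointSum is)
  pointSum-effective is v = sumFin-nonneg (λ k → point-nonneg (is k) v)

  deg-pointSum : ∀ {m} (is : Fin m → Vertex n) → deg (pointSum is) ≡ + m
  deg-pointSum {m} is = begin
    sumFin (λ v → sumFin (λ k → point (is k) v)) ≡⟨ sumFin-comm (λ v k → point (is k) v) ⟩
    sumFin (λ k → deg (point (is k)))            ≡⟨ sumFin-cong (deg-point ∘ is) ⟩
    sumFin {m} (const (+ 1))                     ≡⟨ sumFin-const m (+ 1) ⟩
    + m * + 1                                    ≡⟨ *-identityʳ (+ m) ⟩
    + m                                          ∎
    where open ≡-Reasoning

  deg-⊖ : ∀ {d r} (D E : Divisor n) → r ℕ.≤ d → deg D ≡ + d → deg E ≡ + r →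
          deg (D ⊖ E) ≡ + (d ∸ r)
  deg-⊖ {d} {r} D E r≤d degD degE = begin
    deg (D ⊖ E)     ≡⟨ sumFin-minus D E ⟩
    deg D - deg E   ≡⟨ cong₂ _-_ degD degE ⟩
    + d - + r       ≡⟨ trans (m-n≡m⊖n d r) (⊖-≥ r≤d) ⟩
    + (d ∸ r)       ∎
    where open ≡-Reasoning

  effective⇒pointSum : ∀ m {F : Divisor n} → Effective F → deg F ≡ + m →
                       ∃ λ (is : Fin m → Vertex n) → ∀ v → F v ≡ pointSum is v
  effective⇒pointSum zero    F≥0 degF = (λ ()) , sumFin≡0⇒≡0 F≥0 degF
  effective⇒pointSum (suc m) {F} F≥0 degF with sumFin-positive-term F≥0 degF
  ... | u , 1≤Fu
    with effective⇒pointSum m {F ⊖ point u} F-u≥0 (deg-⊖ F (point u) (s≤s z≤n) degF (deg-point u))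
    where
    F-u≥0 : Effective (F ⊖ point u)
    F-u≥0 v with u ≟ v
    ... | yes refl = i≤j⇒0≤j-i 1≤Fu
    ... | no _     = i≤j⇒0≤j-i (F≥0 v)
  ... | is , F-u≗is = u ∷ is , λ v →
    trans (sym (//-rightDividesˡ (point u v) (F v)))
          (trans (cong (_+ point u v) (F-u≗is v)) (+-comm (pointSum is v) (point u v)))

  infix 25 _·v₀

  _·v₀ : ℕ → Divisor n
  m ·v₀ = pointSum {m} (const zero)

  deg-·v₀ : ∀ m → deg (m ·v₀) ≡ + m
  deg-·v₀ m = deg-pointSum {m} (const zero)

  aSum≡pointSum-·v₀ : ∀ {m} (is : Fin m → Vertex n) v → aSum is v ≡ pointSum is v - (m ·v₀) v
  aSum≡pointSum-·v₀ is v = sumFin-minus (λ k → point (is k) v) (const (point zero v))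

  ·v₀-split : ∀ {r d} → r ℕ.≤ d → ∀ v → (d ·v₀) v ≡ (r ·v₀) v + ((d ∸ r) ·v₀) v
  ·v₀-split {r} r≤d v =
    trans (cong (λ m → (m ·v₀) v) (sym (m+[n∸m]≡n r≤d))) (sumFin-++ {r} (const (point zero v)))

  module _ (G : Graph n) where

    deg-laplacian : (f : Vertex n → ℤ) → deg (laplacian G f) ≡ + 0
    deg-laplacian f = begin
      sumFin (λ v → sumFin (λ w → + mult G v w * (f v - f w)))
        ≡⟨ sumFin-cong (λ v → trans (sumFin-cong (λ w → x[y-z]≈xy-xz (+ mult G v w) (f v) (f w)))
                                    (sumFin-minus (atSource v) (atTarget v))) ⟩
      sumFin (λ v → sumFin (atSource v) - sumFin (atTarget v))
        ≡⟨ sumFin-minus (sumFin ∘ atSource) (sumFin ∘ atTarget) ⟩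
      S - sumFin (sumFin ∘ atTarget)
        ≡⟨ cong (_-_ S) (sumFin-comm atTarget) ⟩
      S - sumFin (λ w → sumFin (λ v → atTarget v w))
        ≡⟨ cong (_-_ S) (sumFin-cong λ w → sumFin-cong λ v →
                           cong (λ k → + k * f w) (symmetric G v w)) ⟩
      S - S
        ≡⟨ +-inverseʳ S ⟩
      + 0 ∎
      where
      open ≡-Reasoning
      atSource atTarget : Vertex n → Vertex n → ℤ
      atSource v w = + mult G v w * f v
      atTarget v w = + mult G v w * f w
      S : ℤ
      S = sumFin (sumFin ∘ atSource)

    Equiv⇒deg≡deg : (D D′ : Divisor n) → Equiv G D D′ → deg D ≡ deg D′
    Equiv⇒deg≡deg D D′ (f , D-D′≡Δf) =
      i-j≡0⇒i≡j (deg D) (deg D′)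
        (trans (sym (sumFin-minus D D′)) (trans (sumFin-cong D-D′≡Δf) (deg-laplacian f)))

    Equiv-resp-difference : (D D′ E E′ : Divisor n) →
                            (∀ v → D v - D′ v ≡ E v - E′ v) → Equiv G D D′ → Equiv G E E′
    Equiv-resp-difference _ _ _ _ same (f , D-D′≡Δf) = f , λ v → trans (sym (same v)) (D-D′≡Δf v)

    module _ {r d} (r≤d : r ℕ.≤ d) (is : Fin r → Vertex n) (js : Fin (d ∸ r) → Vertex n)
             (D₀ D : Divisor n) (D≡D₀+dv₀ : ∀ v → D v ≡ D₀ v + (d ·v₀) v) where

      aSum-difference≡pointSum-difference :
        ∀ v → (D₀ ⊖ aSum is) v - aSum js v ≡ (D ⊖ pointSum is) v - pointSum js v
      aSum-difference≡pointSum-difference v = begin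
        D₀ v - aSum is v - aSum js v
          ≡⟨ cong₂ (λ a b → D₀ v - a - b) (aSum≡pointSum-·v₀ is v) (aSum≡pointSum-·v₀ js v) ⟩
        D₀ v - (pointSum is v - (r ·v₀) v) - (pointSum js v - ((d ∸ r) ·v₀) v)
          ≡⟨ regroup (D₀ v) (pointSum is v) (pointSum js v) ((r ·v₀) v) (((d ∸ r) ·v₀) v) ⟩
        D₀ v + ((r ·v₀) v + ((d ∸ r) ·v₀) v) - pointSum is v - pointSum js v
          ≡⟨ cong (λ x → D₀ v + x - pointSum is v - pointSum js v) (sym (·v₀-split r≤d v)) ⟩
        D₀ v + (d ·v₀) v - pointSum is v - pointSum js v
          ≡⟨ cong (λ x → x - pointSum is v - pointSum js v) (sym (D≡D₀+dv₀ v)) ⟩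
        D v - pointSum is v - pointSum js v ∎
        where
        open ≡-Reasoning
        regroup : ∀ x p q a b → x - (p - a) - (q - b) ≡ x + (a + b) - p - q
        regroup = solve-∀

      Equiv-aSum⇔Equiv-pointSum :
        Equiv G (D₀ ⊖ aSum is) (aSum js) ⇔ Equiv G (D ⊖ pointSum is) (pointSum js)
      Equiv-aSum⇔Equiv-pointSum =
        mk⇔ (Equiv-resp-difference (D₀ ⊖ aSum is) (aSum js) (D ⊖ pointSum is) (pointSum js)
              aSum-difference≡pointSum-difference)
            (Equiv-resp-difference (D ⊖ pointSum is) (pointSum js) (D₀ ⊖ aSum is) (aSum js)
              (sym ∘ aSum-difference≡pointSum-difference))

    rank⇒r≤deg : ∀ {r} (D : Divisor n) → RankAtLeast G D r → + r ≤ deg D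
    rank⇒r≤deg {r} D rk with rk (r ·v₀) (pointSum-effective {r} (const zero)) (deg-·v₀ r)
    ... | F , F≥0 , D-rv₀~F = 0≤i-j⇒j≤i (subst (_≤_ (+ 0)) degF (sumFin-nonneg F≥0))
      where
      degF : deg F ≡ deg D - + r
      degF = begin
        deg F                ≡⟨ sym (Equiv⇒deg≡deg (D ⊖ r ·v₀) F D-rv₀~F) ⟩
        deg (D ⊖ r ·v₀)      ≡⟨ sumFin-minus D (r ·v₀) ⟩
        deg D - deg (r ·v₀)  ≡⟨ cong (_-_ (deg D)) (deg-·v₀ r) ⟩
        deg D - + r          ∎
        where open ≡-Reasoning

    rank⇒JacCond : ∀ {r d} (D : Divisor n) → deg D ≡ + d → RankAtLeast G D r → JacCond G r d
    rank⇒JacCond {r} {d} D degD rk = r≤d , D ⊖ d ·v₀ , deg-D₀ , subset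
      where
      r≤d : r ℕ.≤ d
      r≤d = drop‿+≤+ (subst (_≤_ (+ r)) degD (rank⇒r≤deg D rk))

      deg-D₀ : deg (D ⊖ d ·v₀) ≡ + 0
      deg-D₀ = trans (deg-⊖ D (d ·v₀) ≤-refl degD (deg-·v₀ d)) (cong +_ (n∸n≡0 d))

      D≡D₀+dv₀ : ∀ v → D v ≡ (D ⊖ d ·v₀) v + (d ·v₀) v
      D≡D₀+dv₀ v = sym (//-rightDividesˡ ((d ·v₀) v) (D v))

      subset : SubsetCond G (D ⊖ d ·v₀) r d
      subset is with rk (pointSum is) (pointSum-effective is) (deg-pointSum is)
      ... | F , F≥0 , D-is~F with effective⇒pointSum (d ∸ r) F≥0 degF
        where
        degF : deg F ≡ + (d ∸ r)
        degF = trans (sym (Equiv⇒deg≡deg (D ⊖ pointSum is) F D-is~F))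
                     (deg-⊖ D (pointSum is) r≤d degD (deg-pointSum is))
      ... | js , F≗js =
        js , from (Equiv-aSum⇔Equiv-pointSum r≤d is js (D ⊖ d ·v₀) D D≡D₀+dv₀) D-is~js
        where
        D-is~js : Equiv G (D ⊖ pointSum is) (pointSum js)
        D-is~js = Equiv-resp-difference (D ⊖ pointSum is) F (D ⊖ pointSum is) (pointSum js)
                    (λ v → cong (_-_ (D v - pointSum is v)) (F≗js v)) D-is~F

    SubsetCond⇒rank : ∀ {r d} (D₀ : Divisor n) → r ℕ.≤ d → SubsetCond G D₀ r d →
                      RankAtLeast G (D₀ ⊕ d ·v₀) r
    SubsetCond⇒rank {r} {d} D₀ r≤d subset E E≥0 degE with effective⇒pointSum r E≥0 degE
    ... | is , E≗is with subset is
    ... | js , D₀-is~js = pointSum js , pointSum-effective js , D-E~js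
      where
      D : Divisor n
      D = D₀ ⊕ d ·v₀

      D-E~js : Equiv G (D ⊖ E) (pointSum js)
      D-E~js = Equiv-resp-difference (D ⊖ pointSum is) (pointSum js) (D ⊖ E) (pointSum js)
                 (λ v → cong (λ e → D v - e - pointSum js v) (sym (E≗is v)))
                 (to (Equiv-aSum⇔Equiv-pointSum r≤d is js D₀ D (λ v → refl)) D₀-is~js)

    RankDivisorOfDegree : ℕ → ℕ → Set
    RankDivisorOfDegree r d = Σ (Divisor n) λ D → deg D ≡ + d × RankAtLeast G D r

    RankDivisorOfDegree⇔JacCond : ∀ r d → RankDivisorOfDegree r d ⇔ JacCond G r d
    RankDivisorOfDegree⇔JacCond r d = mk⇔
      (λ (D , degD , rk) → rank⇒JacCond D degD rk)
      (λ (r≤d , D₀ , degD₀ , subset) →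
         D₀ ⊕ d ·v₀ , deg-⊕·v₀ D₀ degD₀ , SubsetCond⇒rank D₀ r≤d subset)
      where
      deg-⊕·v₀ : ∀ D₀ → deg D₀ ≡ + 0 → deg (D₀ ⊕ d ·v₀) ≡ + d
      deg-⊕·v₀ D₀ degD₀ =
        trans (sumFin-+ D₀ (d ·v₀)) (trans (cong₂ _+_ degD₀ (deg-·v₀ d)) (+-identityˡ (+ d)))

    IsGonality⇔IsMinimum : ∀ r g → IsGonality G r g ⇔ IsMinimum (RankDivisorOfDegree r) g
    IsGonality⇔IsMinimum r g = mk⇔
      (λ (witness , minimal) → witness , λ d (D , degD , rk) →
         drop‿+≤+ (subst (_≤_ (+ g)) degD (minimal D rk)))
      (λ (witness , minimal) → witness , λ D rk →
         subst (_≤_ (+ g)) (+∣deg∣≡deg D rk)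
               (+≤+ (minimal ∣ deg D ∣ (D , sym (+∣deg∣≡deg D rk) , rk))))
      where
      +∣deg∣≡deg : ∀ D → RankAtLeast G D r → + ∣ deg D ∣ ≡ deg D
      +∣deg∣≡deg D rk = 0≤i⇒+∣i∣≡i (≤-trans (+≤+ z≤n) (rank⇒r≤deg D rk))

corollary2p4 : (n : ℕ) (G : Graph n) (r g : ℕ) →
    IsGonality G r g ⇔ IsMinimum (JacCond G r) g
corollary2p4 n G r g =
  IsMinimum-cong (RankDivisorOfDegree⇔JacCond G r) g ⇔-∘ IsGonality⇔IsMinimum G r g
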